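{- For every integer $n \ge 0$, let $d_2^e(n)$ (respectively $d_2^o(n)$) be the number of overpartitions of $n$ in which only even parts may be overlined and which have an even (respectively odd) number of parts. For an integer $m$ let $\omega_m = m(3m+1)/2$. Then for all $n \ge 0$, $$d_2^e(n) - d_2^o(n) = \begin{cases} (-1)^m & \text{if } n = \omega_m \text{ for some integer } m,\\ 0 & \text{otherwise}.\end{cases}$$
   Context: An overpartition of $n$ is a partition of $n$ in which the first occurrence of each distinct part value may be overlined; equivalently a pair $(\mu,\nu)$ with $\mu$ a partition (non-overlined parts), $\nu$ a partition into distinct parts (overlined parts), $|\mu|+|\nu|=n$. Overpartitions "in which only even parts may be overlined" are those where all overlined parts are even. The number of parts (length) counts all parts, overlined or not; the empty partition of $0$ has length $0$. The integer $m$ ranges over all integers, including negative ones (the $\omega_m$ are the generalized pentagonal numbers, and for $n$ of this form $m$ is unique). -}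

module Defs where

open import Data.Nat using (ℕ; zero; suc; _+_; _*_; _%_; _≥_; _>_; _≟_; _≤?_; _<?_)
open import Data.Nat.Divisibility using (_∣_; _∣?_)
open import Data.Integer as ℤ using (ℤ; +_; -[1+_]; ∣_∣)
open import Data.List using (List; []; _∷_; map; concatMap; upTo; length; filter; cartesianProduct)
open import Data.Nat.ListAction using (sum)
open import Data.List.Relation.Unary.All using (All; all?)
open import Data.List.Relation.Unary.Linked using (Linked; linked?)
open import Data.Product using (_×_; _,_)
open import Relation.Binary.PropositionalEquality using (_≡_)
open import Relation.Nullary.Decidable using (Dec; _×-dec_)
open import Relation.Unary using (Decidable)

-- An overpartition is encoded as a pair (μ , ν):
--   μ : the non-overlined parts, a weakly decreasing list of positive naturals,
--   ν : the overlined parts, a strictly decreasing list of positive naturals.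
-- "Only even parts may be overlined": every element of ν is even.

OverPair : Set
OverPair = List ℕ × List ℕ

IsEvenOverpartitionOf : ℕ → OverPair → Set
IsEvenOverpartitionOf n (μ , ν) =
  (sum μ + sum ν ≡ n) ×
  (All (λ x → x > 0) μ × Linked _≥_ μ) ×
  (All (λ x → x > 0) ν × Linked _>_ ν × All (λ x → 2 ∣ x) ν)

isEvenOverpartitionOf? : (n : ℕ) → Decidable (IsEvenOverpartitionOf n)
isEvenOverpartitionOf? n (μ , ν) =
  (sum μ + sum ν ≟ n) ×-dec
  ((all? (λ x → 0 <? x) μ ×-dec linked? (λ x y → y ≤? x) μ) ×-dec
   (all? (λ x → 0 <? x) ν ×-dec linked? (λ x y → suc y ≤? x) ν ×-dec all? (λ x → 2 ∣? x) ν))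

listsOf : ℕ → List ℕ → List (List ℕ)
listsOf zero    xs = [] ∷ []
listsOf (suc l) xs = concatMap (λ x → map (x ∷_) (listsOf l xs)) xs

-- all lists of length ≤ n with entries in {0,…,n}; any list of positive parts
-- summing to at most n occurs here
candidates : ℕ → List (List ℕ)
candidates n = concatMap (λ l → listsOf l (upTo (suc n))) (upTo (suc n))

evenOverpartitions : ℕ → List OverPair
evenOverpartitions n =
  filter (isEvenOverpartitionOf? n) (cartesianProduct (candidates n) (candidates n))

numParts : OverPair → ℕ
numParts (μ , ν) = length μ + length ν

d2e : ℕ → ℕ
d2e n = length (filter (λ p → numParts p % 2 ≟ 0) (evenOverpartitions n))

d2o : ℕ → ℕ
d2o n = length (filter (λ p → numParts p % 2 ≟ 1) (evenOverpartitions n))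

negOnePow : ℤ → ℤ
negOnePow m with ∣ m ∣ % 2
... | zero  = + 1
... | suc _ = -[1+ 0 ]

twoOmega : ℤ → ℤ
twoOmega m = m ℤ.* (+ 3 ℤ.* m ℤ.+ + 1)

-- Write an overpartition whose overlined parts are even as the pair (μ , ν) of its
-- non-overlined and overlined parts. Let j be the largest part repeated in μ (0 if
-- there is none) and x the largest part of ν. If 2j ≤ x, replace the overlined x by
-- two non-overlined parts x/2; otherwise, if j > 0, replace two copies of j by an
-- overlined 2j. These two moves undo each other. What remains is ν empty and μ a
-- partition into distinct parts, where Franklin's involution applies (move the
-- smallest part onto the run of consecutive largest parts, or back). Together they
-- form an involution on the overpartitions of n that changes the number of parts by
-- one, except at Franklin's fixed points: the pentagonal staircases, of which there
-- is one, with |m| parts, when n = ω_m, and none otherwise.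

module Submission where

open import Defs
open import Data.Nat as ℕ using (ℕ; zero; suc; pred; _+_; _≤_; _<_; _>_; _≥_; z≤n; s≤s; _%_; _≟_; _≤?_; _<?_; ⌊_/2⌋)
open import Data.Nat.Properties
open import Data.Nat.Divisibility using (_∣_; divides; ∣1⇒≡1)
open import Data.Nat.ListAction using (sum)
open import Data.Nat.ListAction.Properties using (sum-↭)
open import Data.Integer as ℤ using (ℤ; +_; -[1+_]; ∣_∣; _-_; _*_)
import Data.Integer.Properties as ℤ
open import Data.Integer.Tactic.RingSolver using (solve-∀)
open import Algebra.Properties.CommutativeSemigroup ℤ.+-commutativeSemigroup using (x∙yz≈y∙xz)
open import Data.List using (List; []; _∷_; _++_; _∷ʳ_; [_]; length; head; drop; map; concatMap; upTo; filter; cartesianProduct)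
import Data.List.Properties as List
open import Data.List.Relation.Unary.All as All using (All; []; _∷_)
open import Data.List.Relation.Unary.Any as Any using (here; there)
open import Data.List.Relation.Unary.AllPairs using ([]; _∷_)
open import Data.List.Relation.Unary.Linked as Linked using (Linked; []; [-]; _∷_; _∷′_)
open import Data.List.Relation.Unary.Unique.Propositional using (Unique)
import Data.List.Relation.Unary.Unique.Propositional.Properties as Unique
open import Data.List.Membership.Propositional using (_∈_; _∉_; find)
open import Data.List.Membership.Propositional.Properties
  using (∈-filter⁺; ∈-filter⁻; ∈-map⁺; ∈-map⁻; ∈-concatMap⁺; ∈-concatMap⁻; ∈-upTo⁺; ∈-cartesianProduct⁺)
open import Data.List.Relation.Binary.Permutation.Propositional using (_↭_; prep; swap; ↭-refl; ↭-trans; ↭-sym)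
open import Data.List.Relation.Binary.Permutation.Propositional.Properties using (∷↭∷ʳ; ↭-length; All-resp-↭)
open import Data.Maybe using (just)
open import Data.Maybe.Relation.Binary.Connected using (Connected; just; just-nothing)
open import Data.Product using (_×_; _,_; ∃; proj₁; proj₂)
import Data.Product.Properties as Product
open import Data.Sum as Sum using (_⊎_; inj₁; inj₂; [_,_]′)
open import Data.Empty using (⊥; ⊥-elim)
open import Data.Unit using (⊤; tt)
open import Function using (_∘_)
open import Relation.Nullary using (¬_; Dec; yes; no; ¬?; contradiction)
open import Relation.Nullary.Decidable using (_×-dec_; _⊎-dec_)
open import Relation.Unary using (Decidable)
open import Relation.Binary.Definitions using (DecidableEquality)
open import Relation.Binary.PropositionalEquality hiding ([_])

-- Sign-reversing involutions on lists

unique-singleton : ∀ {A : Set} {x : A} {xs} → Unique xs → x ∈ xs → (∀ {y} → y ∈ xs → y ≡ x) → xs ≡ x ∷ []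
unique-singleton {xs = _ ∷ []}    _                (here refl) _     = refl
unique-singleton {xs = y ∷ z ∷ _} ((y≢z ∷ _) ∷ _) _           all≡x = ⊥-elim (y≢z (trans (all≡x (here refl)) (sym (all≡x (there (here refl))))))

no-members : ∀ {A : Set} {xs : List A} → (∀ {y} → y ∉ xs) → xs ≡ []
no-members {xs = []}    _    = refl
no-members {xs = _ ∷ _} ∉xs = ⊥-elim (∉xs (here refl))

weightSum : {A : Set} → (A → ℤ) → List A → ℤ
weightSum w []       = + 0
weightSum w (x ∷ xs) = w x ℤ.+ weightSum w xs

module _ {A : Set} (_≟ᴬ_ : DecidableEquality A) where

  ≢? : (y : A) → Decidable (_≢ y)
  ≢? y z = ¬? (z ≟ᴬ y)

  without : A → List A → List A
  without y = filter (≢? y)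

  weightSum-without : (w : A → ℤ) {y : A} {xs : List A} → Unique xs → y ∈ xs →
                      weightSum w xs ≡ w y ℤ.+ weightSum w (without y xs)
  weightSum-without w {xs = y ∷ xs} (y∉xs ∷ _) (here refl) = begin
    w y ℤ.+ weightSum w xs                           ≡⟨ cong (λ zs → w y ℤ.+ weightSum w zs) (List.filter-all (≢? y) (All.map ≢-sym y∉xs)) ⟨
    w y ℤ.+ weightSum w (without y xs)               ≡⟨ cong (λ zs → w y ℤ.+ weightSum w zs) (List.filter-reject (≢? y) (λ y≢y → y≢y refl)) ⟨
    w y ℤ.+ weightSum w (without y (y ∷ xs))         ∎
    where open ≡-Reasoning
  weightSum-without w {y} {z ∷ xs} (z∉xs ∷ u) (there y∈xs) = begin
    w z ℤ.+ weightSum w xs                           ≡⟨ cong (λ v → w z ℤ.+ v) (weightSum-without w u y∈xs) ⟩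
    w z ℤ.+ (w y ℤ.+ weightSum w (without y xs))     ≡⟨ x∙yz≈y∙xz (w z) (w y) _ ⟩
    w y ℤ.+ weightSum w (z ∷ without y xs)           ≡⟨ cong (λ zs → w y ℤ.+ weightSum w zs) (List.filter-accept (≢? y) z≢y) ⟨
    w y ℤ.+ weightSum w (without y (z ∷ xs))         ∎
    where
    open ≡-Reasoning
    z≢y : z ≢ y
    z≢y refl = All.lookup z∉xs y∈xs refl

  filter-without : {P : A → Set} (P? : Decidable P) {y : A} → ¬ P y → (xs : List A) →
                   filter P? (without y xs) ≡ filter P? xs
  filter-without P? ¬Py [] = refl
  filter-without P? {y} ¬Py (z ∷ xs) with z ≟ᴬ y
  ... | yes refl = trans (filter-without P? ¬Py xs) (sym (List.filter-reject P? ¬Py))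
  ... | no _ with P? z
  ...   | yes _ = cong (z ∷_) (filter-without P? ¬Py xs)
  ...   | no _  = filter-without P? ¬Py xs

  module _ (f : A → A) where

    IsFixed? : Decidable (λ x → f x ≡ x)
    IsFixed? x = f x ≟ᴬ x

    module _ (w : A → ℤ) where

      record SignReversingInvolutionOn (xs : List A) : Set where
        field
          unique         : Unique xs
          closed         : ∀ {x} → x ∈ xs → f x ∈ xs
          involutive     : ∀ {x} → x ∈ xs → f (f x) ≡ x
          sign-reversing : ∀ {x} → x ∈ xs → f x ≢ x → w (f x) ≡ ℤ.- w x

      open SignReversingInvolutionOn

      restrict : ∀ {xs ys} → SignReversingInvolutionOn xs → Unique ys →
                 (∀ {y} → y ∈ ys → y ∈ xs) → (∀ {y} → y ∈ ys → f y ∈ ys) →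
                 SignReversingInvolutionOn ys
      restrict s u ys⊆xs closed′ = record
        { unique         = u
        ; closed         = closed′
        ; involutive     = involutive s ∘ ys⊆xs
        ; sign-reversing = sign-reversing s ∘ ys⊆xs
        }

      module _ {x xs} (s : SignReversingInvolutionOn (x ∷ xs)) where

        private
          x∉xs : All (x ≢_) xs
          x∉xs with unique s
          ... | x∉xs ∷ _ = x∉xs

          unique-xs : Unique xs
          unique-xs with unique s
          ... | _ ∷ u = u

          cancel : ∀ {y z} → y ∈ x ∷ xs → z ∈ x ∷ xs → f y ≡ f z → y ≡ z
          cancel {y} {z} y∈ z∈ fy≡fz = begin
            y       ≡⟨ involutive s y∈ ⟨
            f (f y) ≡⟨ cong f fy≡fz ⟩
            f (f z) ≡⟨ involutive s z∈ ⟩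
            z       ∎
            where open ≡-Reasoning

        restrict-fixed : f x ≡ x → SignReversingInvolutionOn xs
        restrict-fixed fx≡x = restrict s unique-xs there closed′
          where
          closed′ : ∀ {y} → y ∈ xs → f y ∈ xs
          closed′ {y} y∈xs with closed s (there y∈xs)
          ... | there fy∈xs = fy∈xs
          ... | here  fy≡x  = ⊥-elim (All.lookup x∉xs y∈xs (sym (cancel (there y∈xs) (here refl) (trans fy≡x (sym fx≡x)))))

        partner∈ : f x ≢ x → f x ∈ xs
        partner∈ fx≢x with closed s (here refl)
        ... | here  fx≡x  = ⊥-elim (fx≢x fx≡x)
        ... | there fx∈xs = fx∈xs

        restrict-moved : f x ≢ x → SignReversingInvolutionOn (without (f x) xs)
        restrict-moved fx≢x = restrict s (Unique.filter⁺ (≢? (f x)) unique-xs) (there ∘ proj₁ ∘ ∈ys) closed′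
          where
          ∈ys : ∀ {y} → y ∈ without (f x) xs → y ∈ xs × y ≢ f x
          ∈ys = ∈-filter⁻ (≢? (f x)) {xs = xs}
          closed′ : ∀ {y} → y ∈ without (f x) xs → f y ∈ without (f x) xs
          closed′ y∈ys with ∈ys y∈ys
          ... | y∈xs , y≢fx with closed s (there y∈xs)
          ...   | here  fy≡x  = ⊥-elim (y≢fx (cancel (there y∈xs) (closed s (here refl)) (trans fy≡x (sym (involutive s (here refl))))))
          ...   | there fy∈xs = ∈-filter⁺ (≢? (f x)) fy∈xs λ fy≡fx → All.lookup x∉xs y∈xs (sym (cancel (there y∈xs) (here refl) fy≡fx))

        weightSum-moved : f x ≢ x → weightSum w (x ∷ xs) ≡ weightSum w (without (f x) xs)
        weightSum-moved fx≢x = begin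
          w x ℤ.+ weightSum w xs                    ≡⟨ cong (λ v → w x ℤ.+ v) (weightSum-without w unique-xs (partner∈ fx≢x)) ⟩
          w x ℤ.+ (w (f x) ℤ.+ weightSum w ys)      ≡⟨ ℤ.+-assoc (w x) _ _ ⟨
          (w x ℤ.+ w (f x)) ℤ.+ weightSum w ys      ≡⟨ cong (λ v → (w x ℤ.+ v) ℤ.+ weightSum w ys) (sign-reversing s (here refl) fx≢x) ⟩
          (w x ℤ.+ ℤ.- w x) ℤ.+ weightSum w ys      ≡⟨ cong (ℤ._+ weightSum w ys) (ℤ.+-inverseʳ (w x)) ⟩
          + 0 ℤ.+ weightSum w ys                    ≡⟨ ℤ.+-identityˡ _ ⟩
          weightSum w ys                            ∎
          where
          open ≡-Reasoning
          ys : List A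
          ys = without (f x) xs

      weightSum-fixedPoints : ∀ {xs} → SignReversingInvolutionOn xs →
                              weightSum w xs ≡ weightSum w (filter IsFixed? xs)
      weightSum-fixedPoints {xs} = go (length xs) xs ≤-refl
        where
        -- Removing x together with its partner f x is not structural recursion, hence the fuel.
        go : ∀ n xs → length xs ≤ n → SignReversingInvolutionOn xs →
             weightSum w xs ≡ weightSum w (filter IsFixed? xs)
        go _       []       _         _ = refl
        go (suc n) (x ∷ xs) (s≤s len) s with IsFixed? x
        ... | yes fx≡x = cong (λ v → w x ℤ.+ v) (go n xs len (restrict-fixed s fx≡x))
        ... | no  fx≢x = begin
          weightSum w (x ∷ xs)                         ≡⟨ weightSum-moved s fx≢x ⟩
          weightSum w (without (f x) xs)               ≡⟨ go n _ shorter (restrict-moved s fx≢x) ⟩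
          weightSum w (filter IsFixed? (without (f x) xs)) ≡⟨ cong (weightSum w) (filter-without IsFixed? ffx≢fx xs) ⟩
          weightSum w (filter IsFixed? xs)             ∎
          where
          open ≡-Reasoning
          ffx≢fx : f (f x) ≢ f x
          ffx≢fx ffx≡fx = fx≢x (trans (sym ffx≡fx) (involutive s (here refl)))
          shorter : length (without (f x) xs) ≤ n
          shorter = ≤-trans (<⇒≤ (List.filter-notAll (≢? (f x)) xs (Any.map (λ fx≡z z≢fx → z≢fx (sym fx≡z)) (partner∈ s fx≢x)))) len

-- Inserting and removing a pair of equal parts

NonIncreasing Decreasing Positive : List ℕ → Set
NonIncreasing = Linked _≥_
Decreasing    = Linked _>_
Positive      = All (_> 0)

insertPair : ℕ → List ℕ → List ℕ
insertPair j []      = j ∷ j ∷ []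
insertPair j (y ∷ l) with j <? y
... | yes _ = y ∷ insertPair j l
... | no  _ = j ∷ j ∷ y ∷ l

removePair : ℕ → List ℕ → List ℕ
removePair j []      = []
removePair j (y ∷ l) with j <? y
... | yes _ = y ∷ removePair j l
... | no  _ = drop 1 l

data PairAt (j : ℕ) : List ℕ → Set where
  here  : ∀ l → PairAt j (j ∷ j ∷ l)
  there : ∀ {y l} → j < y → PairAt j l → PairAt j (y ∷ l)

private
  largestRepeatedFrom : ℕ → List ℕ → ℕ
  largestRepeatedFrom a []      = 0
  largestRepeatedFrom a (b ∷ l) with a ≟ b
  ... | yes _ = a
  ... | no  _ = largestRepeatedFrom b l

-- 0 stands for "no repeated part": all parts are positive.
largestRepeated : List ℕ → ℕ
largestRepeated []      = 0
largestRepeated (a ∷ l) = largestRepeatedFrom a l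

module _ {j y : ℕ} (l : List ℕ) where

  insertPair-< : j < y → insertPair j (y ∷ l) ≡ y ∷ insertPair j l
  insertPair-< j<y with j <? y
  ... | yes _   = refl
  ... | no  j≮y = ⊥-elim (j≮y j<y)

  insertPair-≮ : ¬ j < y → insertPair j (y ∷ l) ≡ j ∷ j ∷ y ∷ l
  insertPair-≮ j≮y with j <? y
  ... | yes j<y = ⊥-elim (j≮y j<y)
  ... | no  _   = refl

  removePair-< : j < y → removePair j (y ∷ l) ≡ y ∷ removePair j l
  removePair-< j<y with j <? y
  ... | yes _   = refl
  ... | no  j≮y = ⊥-elim (j≮y j<y)

  removePair-≮ : ¬ j < y → removePair j (y ∷ l) ≡ drop 1 l
  removePair-≮ j≮y with j <? y
  ... | yes j<y = ⊥-elim (j≮y j<y)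
  ... | no  _   = refl

removePair-here : ∀ j l → removePair j (j ∷ j ∷ l) ≡ l
removePair-here j l = removePair-≮ {j} (j ∷ l) (<-irrefl refl)

insertPair-↭ : ∀ j l → insertPair j l ↭ j ∷ j ∷ l
insertPair-↭ j []      = ↭-refl
insertPair-↭ j (y ∷ l) with j <? y
... | yes _ = ↭-trans (prep y (insertPair-↭ j l)) (↭-trans (swap y j ↭-refl) (prep j (swap y j ↭-refl)))
... | no  _ = ↭-refl

removePair-insertPair : ∀ j l → removePair j (insertPair j l) ≡ l
removePair-insertPair j []      = removePair-here j []
removePair-insertPair j (y ∷ l) with j <? y
... | yes j<y = trans (removePair-< _ j<y) (cong (y ∷_) (removePair-insertPair j l))
... | no  _   = removePair-here j (y ∷ l)

insertPair-removePair : ∀ {j l} → NonIncreasing l → PairAt j l → insertPair j (removePair j l) ≡ l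
insertPair-removePair {j} (_ ∷ l↓) (here l) = trans (cong (insertPair j) (removePair-here j l)) (reinsert l↓)
  where
  reinsert : ∀ {l} → NonIncreasing (j ∷ l) → insertPair j l ≡ j ∷ j ∷ l
  reinsert {[]}    _         = refl
  reinsert {z ∷ l} (z≤j ∷ _) = insertPair-≮ l (≤⇒≯ z≤j)
insertPair-removePair {j} l↓ (there {y} {l} j<y p) = begin
  insertPair j (removePair j (y ∷ l))   ≡⟨ cong (insertPair j) (removePair-< l j<y) ⟩
  insertPair j (y ∷ removePair j l)     ≡⟨ insertPair-< _ j<y ⟩
  y ∷ insertPair j (removePair j l)     ≡⟨ cong (y ∷_) (insertPair-removePair (Linked.tail l↓) p) ⟩
  y ∷ l                                 ∎
  where open ≡-Reasoning

removePair-↭ : ∀ {j l} → NonIncreasing l → PairAt j l → l ↭ j ∷ j ∷ removePair j l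
removePair-↭ {j} {l} l↓ p = subst (_↭ j ∷ j ∷ removePair j l) (insertPair-removePair l↓ p) (insertPair-↭ j (removePair j l))

insertPair-nonIncreasing : ∀ {j l} → NonIncreasing l → NonIncreasing (insertPair j l)
insertPair-nonIncreasing {j} {[]}    _  = ≤-refl ∷ [-]
insertPair-nonIncreasing {j} {y ∷ l} l↓ with j <? y
... | yes j<y = below l↓ (<⇒≤ j<y)
  where
  below : ∀ {y l} → NonIncreasing (y ∷ l) → j ≤ y → NonIncreasing (y ∷ insertPair j l)
  below {y} {[]}    _          j≤y = j≤y ∷ ≤-refl ∷ [-]
  below {y} {z ∷ l} (z≤y ∷ l↓) j≤y with j <? z
  ... | yes j<z = z≤y ∷ below l↓ (<⇒≤ j<z)
  ... | no  j≮z = j≤y ∷ ≤-refl ∷ ≮⇒≥ j≮z ∷ l↓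
... | no  j≮y = ≤-refl ∷ ≮⇒≥ j≮y ∷ l↓

raiseHead : ∀ {z y l} → z ≤ y → NonIncreasing (z ∷ l) → NonIncreasing (y ∷ l)
raiseHead _   [-]        = [-]
raiseHead z≤y (w≤z ∷ l↓) = ≤-trans w≤z z≤y ∷ l↓

removePair-nonIncreasing : ∀ {j l} → NonIncreasing l → PairAt j l → NonIncreasing (removePair j l)
removePair-nonIncreasing {j} l↓ (here l) rewrite removePair-here j l = Linked.tail (Linked.tail l↓)
removePair-nonIncreasing {j} l↓ (there {y} {l} j<y p) rewrite removePair-< l j<y = below l↓ p
  where
  below : ∀ {y l} → NonIncreasing (y ∷ l) → PairAt j l → NonIncreasing (y ∷ removePair j l)
  below {y} (j≤y ∷ _ ∷ l↓) (here l) rewrite removePair-here j l = raiseHead j≤y l↓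
  below {y} (z≤y ∷ l↓) (there {z} {l} j<z p) rewrite removePair-< l j<z = z≤y ∷ below l↓ p

largestRepeated[a∷a∷l]≡a : ∀ a l → largestRepeated (a ∷ a ∷ l) ≡ a
largestRepeated[a∷a∷l]≡a a l with a ≟ a
... | yes _   = refl
... | no  a≢a = ⊥-elim (a≢a refl)

largestRepeated-∷ : ∀ {y} l → Connected _>_ (just y) (head l) → largestRepeated (y ∷ l) ≡ largestRepeated l
largestRepeated-∷         []      just-nothing = refl
largestRepeated-∷ {y} (z ∷ l) (just z<y) with y ≟ z
... | yes refl = ⊥-elim (<-irrefl refl z<y)
... | no  _    = refl

largestRepeated≤head : ∀ {y l} → NonIncreasing (y ∷ l) → largestRepeated (y ∷ l) ≤ y
largestRepeated≤head         [-]        = z≤n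
largestRepeated≤head {y} {z ∷ l} (z≤y ∷ l↓) with y ≟ z
... | yes _ = ≤-refl
... | no  _ = ≤-trans (largestRepeated≤head l↓) z≤y

largestRepeated-tail≤ : ∀ {y l} → NonIncreasing (y ∷ l) → largestRepeated l ≤ y
largestRepeated-tail≤ [-]        = z≤n
largestRepeated-tail≤ (z≤y ∷ l↓) = ≤-trans (largestRepeated≤head l↓) z≤y

head-below : ∀ {j y l} → NonIncreasing (j ∷ l) → j < y → Connected _>_ (just y) (head l)
head-below [-]        _   = just-nothing
head-below (z≤j ∷ _) j<y = just (≤-<-trans z≤j j<y)

below-largestRepeated : ∀ {y l} → NonIncreasing (y ∷ l) → largestRepeated (y ∷ l) < y → Connected _>_ (just y) (head l)
below-largestRepeated         [-]       _    = just-nothing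
below-largestRepeated {y} {z ∷ l} (z≤y ∷ _) lr<y with y ≟ z
... | yes _   = ⊥-elim (<-irrefl refl lr<y)
... | no  y≢z = just (≤∧≢⇒< z≤y (≢-sym y≢z))

insertPair-below : ∀ {j y} l → j < y → Connected _>_ (just y) (head l) → Connected _>_ (just y) (head (insertPair j l))
insertPair-below     []      j<y _ = just j<y
insertPair-below {j} (z ∷ l) j<y c with j <? z
... | yes _ = c
... | no  _ = just j<y

removePair-below : ∀ {j y l} → NonIncreasing l → PairAt j l → j < y → Connected _>_ (just y) (head l) →
                   Connected _>_ (just y) (head (removePair j l))
removePair-below {j} l↓ (here l) j<y _ rewrite removePair-here j l = head-below (Linked.tail l↓) j<y
removePair-below l↓ (there {l = l} j<z _) _ c rewrite removePair-< l j<z = c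

largestRepeated-insertPair : ∀ {j l} → NonIncreasing l → largestRepeated l ≤ j → largestRepeated (insertPair j l) ≡ j
largestRepeated-insertPair {j} {[]}    _  _    = largestRepeated[a∷a∷l]≡a j []
largestRepeated-insertPair {j} {y ∷ l} l↓ lr≤j with j <? y
... | no  _   = largestRepeated[a∷a∷l]≡a j (y ∷ l)
... | yes j<y = begin
  largestRepeated (y ∷ insertPair j l) ≡⟨ largestRepeated-∷ _ (insertPair-below l j<y y≻l) ⟩
  largestRepeated (insertPair j l)     ≡⟨ largestRepeated-insertPair (Linked.tail l↓) (subst (_≤ j) (largestRepeated-∷ l y≻l) lr≤j) ⟩
  j                                    ∎
  where
  open ≡-Reasoning
  y≻l : Connected _>_ (just y) (head l)
  y≻l = below-largestRepeated l↓ (≤-<-trans lr≤j j<y)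

largestRepeated⇒PairAt : ∀ {j l} → NonIncreasing l → largestRepeated l ≡ j → 0 < j → PairAt j l
largestRepeated⇒PairAt {l = []}    _ refl ()
largestRepeated⇒PairAt {l = _ ∷ []} _ refl ()
largestRepeated⇒PairAt {j} {a ∷ b ∷ l} (b≤a ∷ l↓) lr≡j 0<j with a ≟ b
... | yes refl = subst (λ a → PairAt j (a ∷ a ∷ l)) (sym lr≡j) (here l)
... | no  a≢b  = there (≤-<-trans (subst (_≤ b) lr≡j (largestRepeated≤head l↓)) (≤∧≢⇒< b≤a (≢-sym a≢b)))
                       (largestRepeated⇒PairAt l↓ lr≡j 0<j)

largestRepeated-removePair : ∀ {j l} → NonIncreasing l → PairAt j l → largestRepeated l ≡ j →
                             largestRepeated (removePair j l) ≤ j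
largestRepeated-removePair {j} l↓ (here l) _ rewrite removePair-here j l = largestRepeated-tail≤ (Linked.tail l↓)
largestRepeated-removePair {j} l↓ (there {y} {l} j<y p) lr≡j rewrite removePair-< l j<y =
  subst (_≤ j) (sym (largestRepeated-∷ _ (removePair-below (Linked.tail l↓) p j<y y≻l)))
        (largestRepeated-removePair (Linked.tail l↓) p (trans (sym (largestRepeated-∷ l y≻l)) lr≡j))
  where
  y≻l : Connected _>_ (just y) (head l)
  y≻l = below-largestRepeated l↓ (subst (_< y) (sym lr≡j) j<y)

decreasing⇒largestRepeated≡0 : ∀ {l} → Decreasing l → largestRepeated l ≡ 0
decreasing⇒largestRepeated≡0 []               = refl
decreasing⇒largestRepeated≡0 [-]              = refl
decreasing⇒largestRepeated≡0 {_ ∷ l} (b<a ∷ l↓) = trans (largestRepeated-∷ l (just b<a)) (decreasing⇒largestRepeated≡0 l↓)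

largestRepeated≡0⇒decreasing : ∀ {l} → Positive l → NonIncreasing l → largestRepeated l ≡ 0 → Decreasing l
largestRepeated≡0⇒decreasing _ [] _ = []
largestRepeated≡0⇒decreasing _ [-] _ = [-]
largestRepeated≡0⇒decreasing {a ∷ b ∷ l} (0<a ∷ pos) (b≤a ∷ l↓) lr≡0 with a ≟ b
... | yes refl = ⊥-elim (<⇒≢ 0<a (sym lr≡0))
... | no  a≢b  = ≤∧≢⇒< b≤a (≢-sym a≢b) ∷ largestRepeated≡0⇒decreasing pos l↓ lr≡0

-- Franklin's involution on partitions into distinct parts

smallest : List ℕ → ℕ
smallest []              = 0
smallest (x ∷ [])        = x
smallest (_ ∷ l@(_ ∷ _)) = smallest l

dropSmallest : List ℕ → List ℕ
dropSmallest []              = []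
dropSmallest (_ ∷ [])        = []
dropSmallest (x ∷ l@(_ ∷ _)) = x ∷ dropSmallest l

dropSmallest-∷ʳ-smallest : ∀ x l → dropSmallest (x ∷ l) ∷ʳ smallest (x ∷ l) ≡ x ∷ l
dropSmallest-∷ʳ-smallest x []      = refl
dropSmallest-∷ʳ-smallest x (y ∷ l) = cong (x ∷_) (dropSmallest-∷ʳ-smallest y l)

dropSmallest-∷ʳ : ∀ xs a → dropSmallest (xs ∷ʳ a) ≡ xs
dropSmallest-∷ʳ []           a = refl
dropSmallest-∷ʳ (x ∷ [])     a = refl
dropSmallest-∷ʳ (x ∷ y ∷ xs) a = cong (x ∷_) (dropSmallest-∷ʳ (y ∷ xs) a)

smallest-∷ʳ : ∀ xs a → smallest (xs ∷ʳ a) ≡ a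
smallest-∷ʳ []           a = refl
smallest-∷ʳ (x ∷ [])     a = refl
smallest-∷ʳ (x ∷ y ∷ xs) a = smallest-∷ʳ (y ∷ xs) a

length-∷ʳ : ∀ (xs : List ℕ) a → length (xs ∷ʳ a) ≡ suc (length xs)
length-∷ʳ xs a = sym (↭-length (∷↭∷ʳ a xs))

sum-∷ʳ : ∀ xs a → sum (xs ∷ʳ a) ≡ a + sum xs
sum-∷ʳ xs a = sym (sum-↭ (∷↭∷ʳ a xs))

smallest-positive : ∀ x l → Positive (x ∷ l) → 0 < smallest (x ∷ l)
smallest-positive x []      (0<x ∷ _) = 0<x
smallest-positive x (y ∷ l) (_ ∷ pos) = smallest-positive y l pos

smallest≤ : ∀ {l} → Decreasing l → All (smallest l ≤_) l
smallest≤ []  = []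
smallest≤ [-] = ≤-refl ∷ []
smallest≤ (y<x ∷ l↓) with smallest≤ l↓
... | s≤y ∷ s≤l = ≤-trans s≤y (<⇒≤ y<x) ∷ s≤y ∷ s≤l

dropSmallest-decreasing : ∀ {l} → Decreasing l → Decreasing (dropSmallest l)
dropSmallest-decreasing []               = []
dropSmallest-decreasing [-]              = []
dropSmallest-decreasing (_ ∷ [-])        = [-]
dropSmallest-decreasing (y<x ∷ z<y ∷ l↓) = y<x ∷ dropSmallest-decreasing (z<y ∷ l↓)

smallest<smallest-dropSmallest : ∀ {x y l} → Decreasing (x ∷ y ∷ l) →
                                 smallest (x ∷ y ∷ l) < smallest (dropSmallest (x ∷ y ∷ l))
smallest<smallest-dropSmallest {l = []}    (y<x ∷ _) = y<x
smallest<smallest-dropSmallest {l = _ ∷ _} (_ ∷ l↓)  = smallest<smallest-dropSmallest l↓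

All-dropSmallest : ∀ {P : ℕ → Set} {l} → All P l → All P (dropSmallest l)
All-dropSmallest []             = []
All-dropSmallest (_ ∷ [])       = []
All-dropSmallest (px ∷ py ∷ pl) = px ∷ All-dropSmallest (py ∷ pl)

∷ʳ-decreasing : ∀ {a} xs → Decreasing xs → xs ≢ [] → a < smallest xs → Decreasing (xs ∷ʳ a)
∷ʳ-decreasing []           _          []≢[] _   = ⊥-elim ([]≢[] refl)
∷ʳ-decreasing (x ∷ [])     _          _     a<x = a<x ∷ [-]
∷ʳ-decreasing (x ∷ y ∷ xs) (y<x ∷ l↓) _     a<s = y<x ∷ ∷ʳ-decreasing (y ∷ xs) l↓ (λ ()) a<s

incrementFirst : ℕ → List ℕ → List ℕ
incrementFirst zero    l       = l
incrementFirst (suc n) []      = []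
incrementFirst (suc n) (x ∷ l) = suc x ∷ incrementFirst n l

decrementFirst : ℕ → List ℕ → List ℕ
decrementFirst zero    l       = l
decrementFirst (suc n) []      = []
decrementFirst (suc n) (x ∷ l) = pred x ∷ decrementFirst n l

length-incrementFirst : ∀ n l → length (incrementFirst n l) ≡ length l
length-incrementFirst zero    l       = refl
length-incrementFirst (suc n) []      = refl
length-incrementFirst (suc n) (x ∷ l) = cong suc (length-incrementFirst n l)

length-decrementFirst : ∀ n l → length (decrementFirst n l) ≡ length l
length-decrementFirst zero    l       = refl
length-decrementFirst (suc n) []      = refl
length-decrementFirst (suc n) (x ∷ l) = cong suc (length-decrementFirst n l)

sum-incrementFirst : ∀ n l → n ≤ length l → sum (incrementFirst n l) ≡ n + sum l
sum-incrementFirst zero    l       _         = refl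
sum-incrementFirst (suc n) (x ∷ l) (s≤s n≤l) = cong suc (begin
  x + sum (incrementFirst n l) ≡⟨ cong (_+_ x) (sum-incrementFirst n l n≤l) ⟩
  x + (n + sum l)              ≡⟨ +-assoc x n (sum l) ⟨
  x + n + sum l                ≡⟨ cong (_+ sum l) (+-comm x n) ⟩
  n + x + sum l                ≡⟨ +-assoc n x (sum l) ⟩
  n + (x + sum l)              ∎)
  where open ≡-Reasoning

decrementFirst-incrementFirst : ∀ n l → decrementFirst n (incrementFirst n l) ≡ l
decrementFirst-incrementFirst zero    l       = refl
decrementFirst-incrementFirst (suc n) []      = refl
decrementFirst-incrementFirst (suc n) (x ∷ l) = cong (x ∷_) (decrementFirst-incrementFirst n l)

incrementFirst-decrementFirst : ∀ n {l} → Positive l → incrementFirst n (decrementFirst n l) ≡ l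
incrementFirst-decrementFirst zero    _              = refl
incrementFirst-decrementFirst (suc n) []             = refl
incrementFirst-decrementFirst (suc n) (s≤s _ ∷ pos) = cong (_ ∷_) (incrementFirst-decrementFirst n pos)

sum-decrementFirst : ∀ n l → n ≤ length l → Positive l → n + sum (decrementFirst n l) ≡ sum l
sum-decrementFirst n l n≤l pos = begin
  n + sum (decrementFirst n l)                    ≡⟨ sum-incrementFirst n _ (subst (n ≤_) (sym (length-decrementFirst n l)) n≤l) ⟨
  sum (incrementFirst n (decrementFirst n l))     ≡⟨ cong sum (incrementFirst-decrementFirst n pos) ⟩
  sum l                                           ∎
  where open ≡-Reasoning

incrementFirst-positive : ∀ n {l} → Positive l → Positive (incrementFirst n l)
incrementFirst-positive zero    pos       = pos
incrementFirst-positive (suc n) []        = []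
incrementFirst-positive (suc n) (_ ∷ pos) = s≤s z≤n ∷ incrementFirst-positive n pos

smallest≤smallest-incrementFirst : ∀ n l → smallest l ≤ smallest (incrementFirst n l)
smallest≤smallest-incrementFirst zero          l           = ≤-refl
smallest≤smallest-incrementFirst (suc n)       []          = ≤-refl
smallest≤smallest-incrementFirst (suc zero)    (x ∷ [])    = n≤1+n x
smallest≤smallest-incrementFirst (suc (suc n)) (x ∷ [])    = n≤1+n x
smallest≤smallest-incrementFirst (suc zero)    (x ∷ _ ∷ _) = ≤-refl
smallest≤smallest-incrementFirst (suc (suc n)) (x ∷ y ∷ l) = smallest≤smallest-incrementFirst (suc n) (y ∷ l)

smallest-incrementFirst-all : ∀ n x l → length (x ∷ l) ≤ n → smallest (incrementFirst n (x ∷ l)) ≡ suc (smallest (x ∷ l))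
smallest-incrementFirst-all (suc zero)    x []      _             = refl
smallest-incrementFirst-all (suc (suc n)) x []      _             = refl
smallest-incrementFirst-all (suc zero)    x (y ∷ l) (s≤s ())
smallest-incrementFirst-all (suc (suc n)) x (y ∷ l) (s≤s l≤n)     = smallest-incrementFirst-all (suc n) y l l≤n

smallest-decrementFirst-< : ∀ n l → n < length l → smallest (decrementFirst n l) ≡ smallest l
smallest-decrementFirst-< zero          l           _         = refl
smallest-decrementFirst-< (suc zero)    (x ∷ [])    (s≤s ())
smallest-decrementFirst-< (suc zero)    (x ∷ y ∷ l) _         = refl
smallest-decrementFirst-< (suc (suc n)) (x ∷ y ∷ l) (s≤s n<l) = smallest-decrementFirst-< (suc n) (y ∷ l) n<l

smallest-decrementFirst-all : ∀ n l → length l ≤ n → smallest (decrementFirst n l) ≡ pred (smallest l)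
smallest-decrementFirst-all zero          []          _         = refl
smallest-decrementFirst-all (suc n)       []          _         = refl
smallest-decrementFirst-all (suc zero)    (x ∷ [])    _         = refl
smallest-decrementFirst-all (suc (suc n)) (x ∷ [])    _         = refl
smallest-decrementFirst-all (suc zero)    (x ∷ y ∷ l) (s≤s ())
smallest-decrementFirst-all (suc (suc n)) (x ∷ y ∷ l) (s≤s l≤n) = smallest-decrementFirst-all (suc n) (y ∷ l) l≤n

incrementFirst-decreasing : ∀ n {l} → Decreasing l → Decreasing (incrementFirst n l)
incrementFirst-decreasing zero          l↓         = l↓
incrementFirst-decreasing (suc n)       []         = []
incrementFirst-decreasing (suc zero)    [-]        = [-]
incrementFirst-decreasing (suc (suc n)) [-]        = [-]
incrementFirst-decreasing (suc zero)    (y<x ∷ l↓) = m≤n⇒m≤1+n y<x ∷ l↓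
incrementFirst-decreasing (suc (suc n)) (y<x ∷ l↓) = s≤s y<x ∷ incrementFirst-decreasing (suc n) l↓

private
  runBelow : ℕ → List ℕ → ℕ
  runBelow a []      = 0
  runBelow a (b ∷ l) with a ≟ suc b
  ... | yes _ = suc (runBelow b l)
  ... | no  _ = 0

run : List ℕ → ℕ
run []      = 0
run (a ∷ l) = suc (runBelow a l)

IsRun : ℕ → List ℕ → Set
IsRun zero          _           = ⊤
IsRun (suc _)       []          = ⊥
IsRun (suc zero)    (_ ∷ _)     = ⊤
IsRun (suc (suc n)) (_ ∷ [])    = ⊥
IsRun (suc (suc n)) (a ∷ b ∷ l) = a ≡ suc b × IsRun (suc n) (b ∷ l)

isRun-run : ∀ l → IsRun (run l) l
isRun-run []      = tt
isRun-run (a ∷ l) = below a l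
  where
  below : ∀ a l → IsRun (suc (runBelow a l)) (a ∷ l)
  below a []      = tt
  below a (b ∷ l) with a ≟ suc b
  ... | yes a≡1+b = a≡1+b , below b l
  ... | no  _     = tt

isRun⇒≤run : ∀ n l → IsRun n l → n ≤ run l
isRun⇒≤run zero    l       _ = z≤n
isRun⇒≤run (suc n) (a ∷ l) r = s≤s (below n a l r)
  where
  below : ∀ n a l → IsRun (suc n) (a ∷ l) → n ≤ runBelow a l
  below zero    a l             _           = z≤n
  below (suc n) a (b ∷ l)       (a≡1+b , r) with a ≟ suc b
  ... | yes _    = s≤s (below n b l r)
  ... | no  a≢1+b = ⊥-elim (a≢1+b a≡1+b)

isRun⇒≤length : ∀ n l → IsRun n l → n ≤ length l
isRun⇒≤length zero          l           _       = z≤n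
isRun⇒≤length (suc zero)    (a ∷ l)     _       = s≤s z≤n
isRun⇒≤length (suc (suc n)) (a ∷ b ∷ l) (_ , r) = s≤s (isRun⇒≤length (suc n) (b ∷ l) r)

run≤length : ∀ l → run l ≤ length l
run≤length l = isRun⇒≤length (run l) l (isRun-run l)

isRun-≤ : ∀ {m} n l → IsRun n l → m ≤ n → IsRun m l
isRun-≤ {zero}        _             _           _       _         = tt
isRun-≤ {suc zero}    (suc n)       (a ∷ l)     _       _         = tt
isRun-≤ {suc (suc m)} (suc (suc n)) (a ∷ b ∷ l) (e , r) (s≤s m≤n) = e , isRun-≤ (suc n) (b ∷ l) r m≤n

isRun-++⁻ : ∀ n xs ys → IsRun n (xs ++ ys) → n ≤ length xs → IsRun n xs
isRun-++⁻ zero          xs           ys _       _         = tt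
isRun-++⁻ (suc zero)    (x ∷ xs)     ys _       _         = tt
isRun-++⁻ (suc (suc n)) (x ∷ y ∷ xs) ys (e , r) (s≤s n≤l) = e , isRun-++⁻ (suc n) (y ∷ xs) ys r n≤l

isRun-++⁺ : ∀ n xs ys → IsRun n xs → IsRun n (xs ++ ys)
isRun-++⁺ zero          xs           ys _       = tt
isRun-++⁺ (suc zero)    (x ∷ xs)     ys _       = tt
isRun-++⁺ (suc (suc n)) (x ∷ y ∷ xs) ys (e , r) = e , isRun-++⁺ (suc n) (y ∷ xs) ys r

isRun-incrementFirst : ∀ n l → IsRun n l → IsRun n (incrementFirst n l)
isRun-incrementFirst zero          l           _       = tt
isRun-incrementFirst (suc zero)    (a ∷ l)     _       = tt
isRun-incrementFirst (suc (suc n)) (a ∷ b ∷ l) (e , r) = cong suc e , isRun-incrementFirst (suc n) (b ∷ l) r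

isRun-decrementFirst : ∀ n l → IsRun n l → Positive l → IsRun n (decrementFirst n l)
isRun-decrementFirst zero          l               _          _               = tt
isRun-decrementFirst (suc zero)    (a ∷ l)         _          _               = tt
isRun-decrementFirst (suc (suc n)) (a ∷ suc b ∷ l) (refl , r) (_ ∷ 0<b ∷ pos) = refl , isRun-decrementFirst (suc n) (suc b ∷ l) r (0<b ∷ pos)

run≡ : ∀ n l → IsRun n l → ¬ IsRun (suc n) l → run l ≡ n
run≡ n l r ¬r = ≤-antisym run≤n (isRun⇒≤run n l r)
  where
  run≤n : run l ≤ n
  run≤n with run l ≤? n
  ... | yes run≤n = run≤n
  ... | no  run≰n = ⊥-elim (¬r (isRun-≤ (run l) l (isRun-run l) (≰⇒> run≰n)))

¬isRun-incrementFirst : ∀ s l → Decreasing l → 0 < s → ¬ IsRun (suc s) (incrementFirst s l)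
¬isRun-incrementFirst (suc zero)    (a ∷ b ∷ l) (b<a ∷ _)  _ (e , _) = <⇒≢ b<a (sym (suc-injective e))
¬isRun-incrementFirst (suc (suc s)) (a ∷ b ∷ l) (_ ∷ l↓)   _ (_ , r) = ¬isRun-incrementFirst (suc s) (b ∷ l) l↓ (s≤s z≤n) r

run-incrementFirst : ∀ s l → Decreasing l → IsRun s l → 0 < s → run (incrementFirst s l) ≡ s
run-incrementFirst s l l↓ r 0<s = run≡ s _ (isRun-incrementFirst s l r) (¬isRun-incrementFirst s l l↓ 0<s)

decrementFirst-decreasing : ∀ n {l} → Decreasing l → Positive l → IsRun n l → ¬ IsRun (suc n) l → Decreasing (decrementFirst n l)
decrementFirst-decreasing zero l↓ _ _ _ = l↓
decrementFirst-decreasing (suc zero) [-] _ _ _ = [-]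
decrementFirst-decreasing (suc zero) {suc a ∷ b ∷ l} (b<1+a ∷ l↓) _ _ ¬r = ≤∧≢⇒< (≤-pred b<1+a) (λ b≡a → ¬r (cong suc (sym b≡a) , tt)) ∷ l↓
decrementFirst-decreasing (suc (suc n)) {_ ∷ zero ∷ _} _ (_ ∷ () ∷ _) _ _
decrementFirst-decreasing (suc (suc n)) {a ∷ suc b ∷ l} (_ ∷ l↓) (_ ∷ pos) (refl , r) ¬r =
  ≤-refl ∷ decrementFirst-decreasing (suc n) l↓ pos r (λ r′ → ¬r (refl , r′))

staircase : ℕ → ℕ → List ℕ
staircase zero    s = []
staircase (suc k) s = k + s ∷ staircase k s

length-staircase : ∀ k s → length (staircase k s) ≡ k
length-staircase zero    s = refl
length-staircase (suc k) s = cong suc (length-staircase k s)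

smallest-staircase : ∀ k s → smallest (staircase (suc k) s) ≡ s
smallest-staircase zero    s = refl
smallest-staircase (suc k) s = smallest-staircase k s

staircase-decreasing : ∀ k s → Decreasing (staircase k s)
staircase-decreasing zero          s = []
staircase-decreasing (suc zero)    s = [-]
staircase-decreasing (suc (suc k)) s = ≤-refl ∷ staircase-decreasing (suc k) s

staircase-positive : ∀ k s → 0 < s → Positive (staircase k s)
staircase-positive zero    s 0<s = []
staircase-positive (suc k) s 0<s = ≤-trans 0<s (m≤n+m s k) ∷ staircase-positive k s 0<s

isRun-staircase : ∀ k s → IsRun k (staircase k s)
isRun-staircase zero          s = tt
isRun-staircase (suc zero)    s = tt
isRun-staircase (suc (suc k)) s = refl , isRun-staircase (suc k) s

run-staircase : ∀ k s → run (staircase k s) ≡ k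
run-staircase k s = run≡ k _ (isRun-staircase k s) λ r →
  1+n≰n (subst (suc k ≤_) (length-staircase k s) (isRun⇒≤length (suc k) _ r))

isRun-length⇒staircase : ∀ l → IsRun (length l) l → l ≡ staircase (length l) (smallest l)
isRun-length⇒staircase []          _        = refl
isRun-length⇒staircase (a ∷ [])    _        = refl
isRun-length⇒staircase (a ∷ b ∷ l) (a≡1+b , r) with isRun-length⇒staircase (b ∷ l) r
... | ih = cong₂ _∷_ (trans a≡1+b (cong suc (List.∷-injectiveˡ ih))) ih

-- The run is the whole partition and overlaps the smallest part, so neither move applies.
Exceptional : List ℕ → Set
Exceptional l = run l ≡ length l × (smallest l ≡ length l ⊎ smallest l ≡ suc (length l))

exceptional? : Decidable Exceptional
exceptional? l = run l ≟ length l ×-dec (smallest l ≟ length l ⊎-dec smallest l ≟ suc (length l))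

PentagonalStaircase : List ℕ → Set
PentagonalStaircase l = ∃ λ k → l ≡ staircase k k ⊎ l ≡ staircase k (suc k)

exceptional⇒pentagonalStaircase : ∀ l → Exceptional l → PentagonalStaircase l
exceptional⇒pentagonalStaircase l (run≡len , s≡) with isRun-length⇒staircase l (subst (λ n → IsRun n l) run≡len (isRun-run l))
... | l≡ = length l , Sum.map (λ s≡k → trans l≡ (cong (staircase _) s≡k)) (λ s≡1+k → trans l≡ (cong (staircase _) s≡1+k)) s≡

staircase-exceptional : ∀ k {s} → s ≡ k ⊎ s ≡ suc k → Exceptional (staircase k s)
staircase-exceptional zero    _   = refl , inj₁ refl
staircase-exceptional (suc k) {s} s≡ = trans (run-staircase (suc k) s) (sym |stair|≡1+k)
  , Sum.map (λ s≡1+k → trans (smallest-staircase k s) (trans s≡1+k (sym |stair|≡1+k)))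
            (λ s≡2+k → trans (smallest-staircase k s) (trans s≡2+k (cong suc (sym |stair|≡1+k)))) s≡
  where
  |stair|≡1+k : length (staircase (suc k) s) ≡ suc k
  |stair|≡1+k = length-staircase (suc k) s

spreadSmallest : List ℕ → List ℕ
spreadSmallest l = incrementFirst (smallest l) (dropSmallest l)

shaveRun : List ℕ → List ℕ
shaveRun l = decrementFirst (run l) l ∷ʳ run l

franklin : List ℕ → List ℕ
franklin l with exceptional? l | smallest l ≤? run l
... | yes _ | _     = l
... | no  _ | yes _ = spreadSmallest l
... | no  _ | no  _ = shaveRun l

module _ (l : List ℕ) where

  franklin-exceptional : Exceptional l → franklin l ≡ l
  franklin-exceptional exc with exceptional? l
  ... | yes _    = refl
  ... | no  ¬exc = ⊥-elim (¬exc exc)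

  franklin-spread : ¬ Exceptional l → smallest l ≤ run l → franklin l ≡ spreadSmallest l
  franklin-spread ¬exc s≤σ with exceptional? l | smallest l ≤? run l
  ... | yes exc | _       = ⊥-elim (¬exc exc)
  ... | no  _   | yes _   = refl
  ... | no  _   | no  s≰σ = ⊥-elim (s≰σ s≤σ)

  franklin-shave : ¬ Exceptional l → ¬ smallest l ≤ run l → franklin l ≡ shaveRun l
  franklin-shave ¬exc s≰σ with exceptional? l | smallest l ≤? run l
  ... | yes exc | _       = ⊥-elim (¬exc exc)
  ... | no  _   | yes s≤σ = ⊥-elim (s≰σ s≤σ)
  ... | no  _   | no  _   = refl

record FranklinPair (l m : List ℕ) : Set where
  field
    decreasing    : Decreasing m
    positive      : Positive m
    sum-≡         : sum m ≡ sum l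
    inverse       : franklin m ≡ l
    length-differs : length m ≡ suc (length l) ⊎ length l ≡ suc (length m)

module SpreadSmallest {x y r} (l↓ : Decreasing (x ∷ y ∷ r)) (pos : Positive (x ∷ y ∷ r))
                      (¬exc : ¬ Exceptional (x ∷ y ∷ r)) (s≤σ : smallest (x ∷ y ∷ r) ≤ run (x ∷ y ∷ r)) where

  private
    l xs m : List ℕ
    l  = x ∷ y ∷ r
    xs = dropSmallest l
    m  = spreadSmallest l

    s : ℕ
    s = smallest l

    xs∷ʳs≡l : xs ∷ʳ s ≡ l
    xs∷ʳs≡l = dropSmallest-∷ʳ-smallest x (y ∷ r)

    |l|≡1+|xs| : length l ≡ suc (length xs)
    |l|≡1+|xs| = trans (cong length (sym xs∷ʳs≡l)) (length-∷ʳ xs s)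

    s≤|xs| : s ≤ length xs
    s≤|xs| = ≤-pred (subst (s <_) |l|≡1+|xs| s<|l|)
      where
      s<|l| : s < length l
      s<|l| = ≤∧≢⇒< (≤-trans s≤σ (run≤length l))
                     (λ s≡k → ¬exc (≤-antisym (run≤length l) (subst (_≤ run l) s≡k s≤σ) , inj₁ s≡k))

    xs↓ : Decreasing xs
    xs↓ = dropSmallest-decreasing l↓

    run-m : run m ≡ s
    run-m = run-incrementFirst s xs xs↓
      (isRun-++⁻ s xs [ s ] (subst (IsRun s) (sym xs∷ʳs≡l) (isRun-≤ (run l) l (isRun-run l) s≤σ)) s≤|xs|)
      (smallest-positive x (y ∷ r) pos)

    s<smallest-xs : s < smallest xs
    s<smallest-xs = smallest<smallest-dropSmallest l↓

    s′≰σ′ : ¬ smallest m ≤ run m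
    s′≰σ′ s′≤σ′ = <⇒≱ (<-≤-trans s<smallest-xs (smallest≤smallest-incrementFirst s xs)) (subst (smallest m ≤_) run-m s′≤σ′)

    ¬exc′ : ¬ Exceptional m
    ¬exc′ (σ′≡k′ , s′≡) = <⇒≱ (s≤s s<smallest-xs) (subst (_≤ suc s) s′≡1+smallest-xs s′≤1+s)
      where
      |m|≡s : length m ≡ s
      |m|≡s = trans (sym σ′≡k′) run-m
      s′≡1+smallest-xs : smallest m ≡ suc (smallest xs)
      s′≡1+smallest-xs = smallest-incrementFirst-all s x (dropSmallest (y ∷ r))
                            (subst (_≤ s) (length-incrementFirst s xs) (≤-reflexive |m|≡s))
      s′≤1+s : smallest m ≤ suc s
      s′≤1+s = [ (λ e → ≤-trans (≤-reflexive (trans e |m|≡s)) (n≤1+n s)) , (λ e → ≤-reflexive (trans e (cong suc |m|≡s))) ]′ s′≡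

  pair : FranklinPair l m
  pair = record
    { decreasing     = incrementFirst-decreasing s xs↓
    ; positive       = incrementFirst-positive s (All-dropSmallest pos)
    ; sum-≡          = trans (sum-incrementFirst s xs s≤|xs|) (trans (sym (sum-∷ʳ xs s)) (cong sum xs∷ʳs≡l))
    ; inverse        = begin
        franklin m                        ≡⟨ franklin-shave m ¬exc′ s′≰σ′ ⟩
        decrementFirst (run m) m ∷ʳ run m ≡⟨ cong (λ σ′ → decrementFirst σ′ m ∷ʳ σ′) run-m ⟩
        decrementFirst s m ∷ʳ s           ≡⟨ cong (_∷ʳ s) (decrementFirst-incrementFirst s xs) ⟩
        xs ∷ʳ s                           ≡⟨ xs∷ʳs≡l ⟩
        l                                 ∎
    ; length-differs = inj₂ (trans |l|≡1+|xs| (cong suc (sym (length-incrementFirst s xs))))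
    }
    where open ≡-Reasoning

spreadSmallest-pair : ∀ {l} → Decreasing l → Positive l → ¬ Exceptional l → smallest l ≤ run l →
                      FranklinPair l (spreadSmallest l)
spreadSmallest-pair {[]}        _  _         ¬exc _   = ⊥-elim (¬exc (refl , inj₁ refl))
spreadSmallest-pair {x ∷ []}    _  (0<x ∷ _) ¬exc s≤σ = ⊥-elim (¬exc (refl , inj₁ (≤-antisym s≤σ 0<x)))
spreadSmallest-pair {_ ∷ _ ∷ _} l↓ pos       ¬exc s≤σ = SpreadSmallest.pair l↓ pos ¬exc s≤σ

module ShaveRun {x r} (l↓ : Decreasing (x ∷ r)) (pos : Positive (x ∷ r))
                 (¬exc : ¬ Exceptional (x ∷ r)) (s≰σ : ¬ smallest (x ∷ r) ≤ run (x ∷ r)) where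

  private
    l ys m : List ℕ
    l  = x ∷ r
    ys = decrementFirst (run l) l
    m  = shaveRun l

    s σ k : ℕ
    s = smallest l
    σ = run l
    k = length l

    |ys|≡k : length ys ≡ k
    |ys|≡k = length-decrementFirst σ l

    |m|≡1+k : length m ≡ suc k
    |m|≡1+k = trans (length-∷ʳ ys σ) (cong suc |ys|≡k)

    σ<smallest-ys : σ < smallest ys
    σ<smallest-ys with σ <? k
    ... | yes σ<k = subst (σ <_) (sym (smallest-decrementFirst-< σ l σ<k)) σ<s
      where
      σ<s : σ < s
      σ<s = ≰⇒> s≰σ
    ... | no  σ≮k = subst (σ <_) (sym (smallest-decrementFirst-all σ l (≮⇒≥ σ≮k))) (<pred (≰⇒> s≰σ) s≢1+σ)
      where
      s≢1+σ : s ≢ suc σ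
      s≢1+σ s≡1+σ = ¬exc (σ≡k , inj₂ (trans s≡1+σ (cong suc σ≡k)))
        where
        σ≡k : σ ≡ k
        σ≡k = ≤-antisym (run≤length l) (≮⇒≥ σ≮k)
      <pred : ∀ {a b} → a < b → b ≢ suc a → a < pred b
      <pred {b = suc b} (s≤s a≤b) b≢1+a = ≤∧≢⇒< a≤b (λ a≡b → b≢1+a (cong suc (sym a≡b)))

    m↓ : Decreasing m
    m↓ = ∷ʳ-decreasing ys (decrementFirst-decreasing σ l↓ pos (isRun-run l) (λ r → 1+n≰n (isRun⇒≤run (suc σ) l r)))
                       (λ ys≡[] → 0≢1+n (trans (sym (cong length ys≡[])) |ys|≡k)) σ<smallest-ys

    s′≤σ′ : smallest m ≤ run m
    s′≤σ′ = subst (_≤ run m) (sym (smallest-∷ʳ ys σ))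
              (isRun⇒≤run σ m (isRun-++⁺ σ ys [ σ ] (isRun-decrementFirst σ l (isRun-run l) pos)))

    ¬exc′ : ¬ Exceptional m
    ¬exc′ (_ , s′≡) = 1+n≰n (begin
      suc σ       ≤⟨ s≤s (run≤length l) ⟩
      suc k       ≡⟨ |m|≡1+k ⟨
      length m    ≤⟨ [ ≤-reflexive ∘ sym , (λ e → ≤-trans (n≤1+n _) (≤-reflexive (sym e))) ]′ s′≡ ⟩
      smallest m  ≡⟨ smallest-∷ʳ ys σ ⟩
      σ           ∎)
      where open ≤-Reasoning

  pair : FranklinPair l m
  pair = record
    { decreasing     = m↓
    ; positive       = All.map (λ σ≤y → ≤-trans (s≤s z≤n) (subst (_≤ _) (smallest-∷ʳ ys σ) σ≤y)) (smallest≤ m↓)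
    ; sum-≡          = trans (sum-∷ʳ ys σ) (sum-decrementFirst σ l (run≤length l) pos)
    ; inverse        = begin
        franklin m                                   ≡⟨ franklin-spread m ¬exc′ s′≤σ′ ⟩
        incrementFirst (smallest m) (dropSmallest m) ≡⟨ cong₂ incrementFirst (smallest-∷ʳ ys σ) (dropSmallest-∷ʳ ys σ) ⟩
        incrementFirst σ ys                          ≡⟨ incrementFirst-decrementFirst σ pos ⟩
        l                                            ∎
    ; length-differs = inj₁ |m|≡1+k
    }
    where open ≡-Reasoning

shaveRun-pair : ∀ {l} → Decreasing l → Positive l → ¬ Exceptional l → ¬ smallest l ≤ run l →
                FranklinPair l (shaveRun l)
shaveRun-pair {[]}    _  _   _    s≰σ = ⊥-elim (s≰σ z≤n)
shaveRun-pair {_ ∷ _} l↓ pos ¬exc s≰σ = ShaveRun.pair l↓ pos ¬exc s≰σ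

franklin-cases : ∀ {l} → Decreasing l → Positive l → Exceptional l ⊎ FranklinPair l (franklin l)
franklin-cases {l} l↓ pos with exceptional? l | smallest l ≤? run l
... | yes exc  | _       = inj₁ exc
... | no  ¬exc | yes s≤σ = inj₂ (spreadSmallest-pair l↓ pos ¬exc s≤σ)
... | no  ¬exc | no  s≰σ = inj₂ (shaveRun-pair l↓ pos ¬exc s≰σ)

-- The enumeration of even overpartitions

concatMap-unique : ∀ {A B : Set} (f : A → List B) {xs} → Unique xs → (∀ x → Unique (f x)) →
                   (∀ {x y v} → v ∈ f x → v ∈ f y → x ≡ y) → Unique (concatMap f xs)
concatMap-unique f {[]}     _           _       _        = []
concatMap-unique f {x ∷ xs} (x∉xs ∷ u) unique-f disjoint =
  Unique.++⁺ (unique-f x) (concatMap-unique f u unique-f disjoint) λ (v∈fx , v∈rest) →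
    let (y , y∈xs , v∈fy) = find (∈-concatMap⁻ f {xs = xs} v∈rest)
    in All.lookup x∉xs y∈xs (disjoint v∈fx v∈fy)

length-listsOf : ∀ l xs {v} → v ∈ listsOf l xs → length v ≡ l
length-listsOf zero    xs (here refl) = refl
length-listsOf (suc l) xs v∈ with find (∈-concatMap⁻ (λ x → map (x ∷_) (listsOf l xs)) {xs = xs} v∈)
... | y , _ , v∈y∷ with ∈-map⁻ (y ∷_) v∈y∷
...   | w , w∈ , refl = cong suc (length-listsOf l xs w∈)

listsOf-unique : ∀ l {xs} → Unique xs → Unique (listsOf l xs)
listsOf-unique zero    u = [] ∷ []
listsOf-unique (suc l) u = concatMap-unique _ u (λ x → Unique.map⁺ List.∷-injectiveʳ (listsOf-unique l u)) disjoint
  where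
  disjoint : ∀ {x y v} → v ∈ map (x ∷_) (listsOf l _) → v ∈ map (y ∷_) (listsOf l _) → x ≡ y
  disjoint v∈x v∈y with ∈-map⁻ _ v∈x | ∈-map⁻ _ v∈y
  ... | _ , _ , refl | _ , _ , refl = refl

∈-listsOf : ∀ {xs} v → All (_∈ xs) v → v ∈ listsOf (length v) xs
∈-listsOf []      _            = here refl
∈-listsOf (x ∷ v) (x∈xs ∷ v⊆xs) =
  ∈-concatMap⁺ _ (Any.map (λ { refl → ∈-map⁺ (x ∷_) (∈-listsOf v v⊆xs) }) x∈xs)

candidates-unique : ∀ n → Unique (candidates n)
candidates-unique n = concatMap-unique _ (Unique.upTo⁺ (suc n)) (λ l → listsOf-unique l (Unique.upTo⁺ (suc n)))
  (λ v∈x v∈y → trans (sym (length-listsOf _ _ v∈x)) (length-listsOf _ _ v∈y))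

length≤sum : ∀ {v} → Positive v → length v ≤ sum v
length≤sum []          = z≤n
length≤sum (0<x ∷ pos) = +-mono-≤ 0<x (length≤sum pos)

all≤sum : ∀ v → All (_≤ sum v) v
all≤sum []      = []
all≤sum (x ∷ v) = m≤m+n x (sum v) ∷ All.map (λ y≤ → ≤-trans y≤ (m≤n+m (sum v) x)) (all≤sum v)

∈-candidates : ∀ {n v} → Positive v → sum v ≤ n → v ∈ candidates n
∈-candidates {n} {v} pos sum≤n = ∈-concatMap⁺ (λ l → listsOf l (upTo (suc n)))
  (Any.map (λ { refl → ∈-listsOf v entries }) (∈-upTo⁺ (s≤s (≤-trans (length≤sum pos) sum≤n))))
  where
  entries : All (_∈ upTo (suc n)) v
  entries = All.map (λ y≤ → ∈-upTo⁺ (s≤s (≤-trans y≤ sum≤n))) (all≤sum v)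

evenOverpartitions-unique : ∀ n → Unique (evenOverpartitions n)
evenOverpartitions-unique n =
  Unique.filter⁺ (isEvenOverpartitionOf? n) (Unique.cartesianProduct⁺ (candidates-unique n) (candidates-unique n))

∈-evenOverpartitions : ∀ {n p} → IsEvenOverpartitionOf n p → p ∈ evenOverpartitions n
∈-evenOverpartitions {n} {μ , ν} p@(sum≡n , (μ-pos , _) , (ν-pos , _)) = ∈-filter⁺ (isEvenOverpartitionOf? n)
  (∈-cartesianProduct⁺ (∈-candidates μ-pos (subst (sum μ ≤_) sum≡n (m≤m+n _ _)))
                       (∈-candidates ν-pos (subst (sum ν ≤_) sum≡n (m≤n+m _ _)))) p

evenOverpartitions-sound : ∀ {n p} → p ∈ evenOverpartitions n → IsEvenOverpartitionOf n p
evenOverpartitions-sound {n} p∈ = proj₂ (∈-filter⁻ (isEvenOverpartitionOf? n) {xs = cartesianProduct (candidates n) (candidates n)} p∈)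

-- The involution on even overpartitions

⌊n+n/2⌋≡n : ∀ n → ⌊ n + n /2⌋ ≡ n
⌊n+n/2⌋≡n zero    = refl
⌊n+n/2⌋≡n (suc n) = trans (cong (λ m → ⌊ suc m /2⌋) (+-suc n n)) (cong suc (⌊n+n/2⌋≡n n))

even⇒⌊n/2⌋+⌊n/2⌋ : ∀ {n} → 2 ∣ n → n ≡ ⌊ n /2⌋ + ⌊ n /2⌋
even⇒⌊n/2⌋+⌊n/2⌋ {n} (divides q n≡q*2) = trans n≡q+q (cong (λ m → m + m) (sym ⌊n/2⌋≡q))
  where
  n≡q+q : n ≡ q + q
  n≡q+q = trans n≡q*2 (trans (*-comm q 2) (cong (_+_ q) (+-identityʳ q)))
  ⌊n/2⌋≡q : ⌊ n /2⌋ ≡ q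
  ⌊n/2⌋≡q = trans (cong ⌊_/2⌋ n≡q+q) (⌊n+n/2⌋≡n q)

mergePair : List ℕ → List ℕ → OverPair
mergePair μ ν = removePair j μ , (j + j) ∷ ν
  where
  j : ℕ
  j = largestRepeated μ

involution : OverPair → OverPair
involution (μ , []) with largestRepeated μ ≟ 0
... | yes _ = franklin μ , []
... | no  _ = mergePair μ []
involution (μ , x ∷ ν) with largestRepeated μ + largestRepeated μ ≤? x
... | yes _ = insertPair ⌊ x /2⌋ μ , ν
... | no  _ = mergePair μ (x ∷ ν)

involution-franklin : ∀ μ → largestRepeated μ ≡ 0 → involution (μ , []) ≡ (franklin μ , [])
involution-franklin μ j≡0 with largestRepeated μ ≟ 0
... | yes _   = refl
... | no  j≢0 = ⊥-elim (j≢0 j≡0)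

involution-merge : ∀ μ ν → 0 < largestRepeated μ →
                   Connected _>_ (just (largestRepeated μ + largestRepeated μ)) (head ν) →
                   involution (μ , ν) ≡ mergePair μ ν
involution-merge μ []      0<j _ with largestRepeated μ ≟ 0
... | yes j≡0 = ⊥-elim (<⇒≢ 0<j (sym j≡0))
... | no  _   = refl
involution-merge μ (x ∷ ν) _ (just x<2j) with largestRepeated μ + largestRepeated μ ≤? x
... | yes 2j≤x = ⊥-elim (<⇒≱ x<2j 2j≤x)
... | no  _    = refl

involution-split : ∀ μ x ν → largestRepeated μ + largestRepeated μ ≤ x →
                   involution (μ , x ∷ ν) ≡ (insertPair ⌊ x /2⌋ μ , ν)
involution-split μ x ν 2j≤x with largestRepeated μ + largestRepeated μ ≤? x
... | yes _    = refl
... | no  2j≰x = ⊥-elim (2j≰x 2j≤x)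

NumPartsAdjacent : OverPair → OverPair → Set
NumPartsAdjacent p q = numParts q ≡ suc (numParts p) ⊎ numParts p ≡ suc (numParts q)

PentagonalFixedPoint : OverPair → Set
PentagonalFixedPoint (μ , ν) = ν ≡ [] × PentagonalStaircase μ

record InvolutionAt (n : ℕ) (p : OverPair) : Set where
  field
    valid          : IsEvenOverpartitionOf n (involution p)
    involutive     : involution (involution p) ≡ p
    fixed-or-moves : (involution p ≡ p × PentagonalFixedPoint p) ⊎ NumPartsAdjacent p (involution p)

private
  regroup : ∀ a b c → a + ((b + b) + c) ≡ (b + (b + a)) + c
  regroup a b c = begin
    a + ((b + b) + c)   ≡⟨ +-assoc a (b + b) c ⟨
    (a + (b + b)) + c   ≡⟨ cong (_+ c) (+-comm a (b + b)) ⟩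
    ((b + b) + a) + c   ≡⟨ cong (_+ c) (+-assoc b b a) ⟩
    (b + (b + a)) + c   ∎
    where open ≡-Reasoning

merge-involutionAt : ∀ {n μ ν} → IsEvenOverpartitionOf n (μ , ν) → 0 < largestRepeated μ →
                     Connected _>_ (just (largestRepeated μ + largestRepeated μ)) (head ν) → InvolutionAt n (μ , ν)
merge-involutionAt {n} {μ} {ν} (sum≡n , (μ-pos , μ↓) , (ν-pos , ν↓ , ν-even)) 0<j connected = record
  { valid          = subst (IsEvenOverpartitionOf n) (sym merge≡)
      ( trans (regroup (sum μ′) j (sum ν)) (trans (cong (_+ sum ν) (sym (sum-↭ μ↭))) sum≡n)
      , (μ′-pos , removePair-nonIncreasing μ↓ pair)
      , (≤-trans 0<j (m≤m+n j j) ∷ ν-pos , connected ∷′ ν↓ , divides j (trans (cong (_+_ j) (sym (+-identityʳ j))) (*-comm 2 j)) ∷ ν-even))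
  ; involutive     = begin
      involution (involution (μ , ν))      ≡⟨ cong involution merge≡ ⟩
      involution (μ′ , (j + j) ∷ ν)        ≡⟨ involution-split μ′ (j + j) ν (+-mono-≤ j′≤j j′≤j) ⟩
      (insertPair ⌊ j + j /2⌋ μ′ , ν)      ≡⟨ cong (λ h → insertPair h μ′ , ν) (⌊n+n/2⌋≡n j) ⟩
      (insertPair j μ′ , ν)                ≡⟨ cong (_, ν) (insertPair-removePair μ↓ pair) ⟩
      (μ , ν)                              ∎
  ; fixed-or-moves = inj₂ (inj₂ (begin
      length μ + length ν                  ≡⟨ cong (_+ length ν) (↭-length μ↭) ⟩
      suc (suc (length μ′)) + length ν     ≡⟨ cong suc (+-suc (length μ′) (length ν)) ⟨
      suc (numParts (mergePair μ ν))       ≡⟨ cong (suc ∘ numParts) merge≡ ⟨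
      suc (numParts (involution (μ , ν)))  ∎))
  }
  where
  open ≡-Reasoning
  j : ℕ
  j = largestRepeated μ
  μ′ : List ℕ
  μ′ = removePair j μ
  pair : PairAt j μ
  pair = largestRepeated⇒PairAt μ↓ refl 0<j
  μ↭ : μ ↭ j ∷ j ∷ μ′
  μ↭ = removePair-↭ μ↓ pair
  merge≡ : involution (μ , ν) ≡ mergePair μ ν
  merge≡ = involution-merge μ ν 0<j connected
  μ′-pos : Positive μ′
  μ′-pos with All-resp-↭ μ↭ μ-pos
  ... | _ ∷ _ ∷ pos = pos
  j′≤j : largestRepeated μ′ ≤ j
  j′≤j = largestRepeated-removePair μ↓ pair refl

split-involutionAt : ∀ {n μ x ν} → IsEvenOverpartitionOf n (μ , x ∷ ν) →
                     largestRepeated μ + largestRepeated μ ≤ x → InvolutionAt n (μ , x ∷ ν)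
split-involutionAt {n} {μ} {x} {ν} (sum≡n , (μ-pos , μ↓) , (0<x ∷ ν-pos , xν↓ , x-even ∷ ν-even)) 2j≤x = record
  { valid          = subst (IsEvenOverpartitionOf n) (sym split≡)
      ( trans (cong (_+ sum ν) (sum-↭ (insertPair-↭ h μ)))
          (trans (sym (regroup (sum μ) h (sum ν))) (trans (cong (λ y → sum μ + (y + sum ν)) (sym x≡h+h)) sum≡n))
      , (All-resp-↭ (↭-sym (insertPair-↭ h μ)) (0<h ∷ 0<h ∷ μ-pos) , insertPair-nonIncreasing μ↓)
      , (ν-pos , Linked.tail xν↓ , ν-even))
  ; involutive     = begin
      involution (involution (μ , x ∷ ν))           ≡⟨ cong involution split≡ ⟩
      involution (μ″ , ν)                           ≡⟨ involution-merge μ″ ν (subst (0 <_) (sym j″≡h) 0<h) connected ⟩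
      (removePair j″ μ″ , (j″ + j″) ∷ ν)            ≡⟨ cong (λ j → removePair j μ″ , (j + j) ∷ ν) j″≡h ⟩
      (removePair h μ″ , (h + h) ∷ ν)               ≡⟨ cong₂ (λ μ y → μ , y ∷ ν) (removePair-insertPair h μ) (sym x≡h+h) ⟩
      (μ , x ∷ ν)                                   ∎
  ; fixed-or-moves = inj₂ (inj₁ (begin
      numParts (involution (μ , x ∷ ν))             ≡⟨ cong numParts split≡ ⟩
      length μ″ + length ν                          ≡⟨ cong (_+ length ν) (↭-length (insertPair-↭ h μ)) ⟩
      suc (suc (length μ)) + length ν               ≡⟨ cong suc (+-suc (length μ) (length ν)) ⟨
      suc (length μ + length (x ∷ ν))               ∎))
  }
  where
  open ≡-Reasoning
  j : ℕ
  j = largestRepeated μ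
  h : ℕ
  h = ⌊ x /2⌋
  μ″ : List ℕ
  μ″ = insertPair h μ
  j″ : ℕ
  j″ = largestRepeated μ″
  x≡h+h : x ≡ h + h
  x≡h+h = even⇒⌊n/2⌋+⌊n/2⌋ x-even
  0<h : 0 < h
  0<h = n≢0⇒n>0 (λ h≡0 → <⇒≢ 0<x (sym (trans x≡h+h (cong (λ m → m + m) h≡0))))
  j≤h : j ≤ h
  j≤h = ≮⇒≥ (λ h<j → <⇒≱ (+-mono-< h<j h<j) (subst (j + j ≤_) x≡h+h 2j≤x))
  j″≡h : j″ ≡ h
  j″≡h = largestRepeated-insertPair μ↓ j≤h
  split≡ : involution (μ , x ∷ ν) ≡ (μ″ , ν)
  split≡ = involution-split μ x ν 2j≤x
  connected : Connected _>_ (just (j″ + j″)) (head ν)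
  connected = subst (λ y → Connected _>_ (just y) (head ν)) (trans x≡h+h (cong (λ m → m + m) (sym j″≡h))) (Linked.head′ xν↓)

franklin-involutionAt : ∀ {n μ} → IsEvenOverpartitionOf n (μ , []) → largestRepeated μ ≡ 0 → InvolutionAt n (μ , [])
franklin-involutionAt {n} {μ} v@(sum≡n , (μ-pos , μ↓) , _) j≡0
  with franklin-cases (largestRepeated≡0⇒decreasing μ-pos μ↓ j≡0) μ-pos
... | inj₁ exc = record
  { valid          = subst (IsEvenOverpartitionOf n) (sym fixed) v
  ; involutive     = trans (cong involution fixed) fixed
  ; fixed-or-moves = inj₁ (fixed , refl , exceptional⇒pentagonalStaircase μ exc)
  }
  where
  fixed : involution (μ , []) ≡ (μ , [])
  fixed = trans (involution-franklin μ j≡0) (cong (_, []) (franklin-exceptional μ exc))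
... | inj₂ pair = record
  { valid          = subst (IsEvenOverpartitionOf n) (sym step)
      (trans (cong (_+ 0) sum-≡) sum≡n , (positive , Linked.map <⇒≤ decreasing) , ([] , [] , []))
  ; involutive     = begin
      involution (involution (μ , []))  ≡⟨ cong involution step ⟩
      involution (franklin μ , [])      ≡⟨ involution-franklin (franklin μ) (decreasing⇒largestRepeated≡0 decreasing) ⟩
      (franklin (franklin μ) , [])      ≡⟨ cong (_, []) inverse ⟩
      (μ , [])                          ∎
  ; fixed-or-moves = inj₂ (subst (NumPartsAdjacent (μ , [])) (sym step) (Sum.map (withoutOverlined μ (franklin μ)) (withoutOverlined (franklin μ) μ) length-differs))
  }
  where
  open ≡-Reasoning
  open FranklinPair pair
  step : involution (μ , []) ≡ (franklin μ , [])
  step = involution-franklin μ j≡0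
  withoutOverlined : ∀ a b → length b ≡ suc (length a) → numParts (b , []) ≡ suc (numParts (a , []))
  withoutOverlined a b e = trans (+-identityʳ (length b)) (trans e (cong suc (sym (+-identityʳ (length a)))))

involutionAt : ∀ {n} p → IsEvenOverpartitionOf n p → InvolutionAt n p
involutionAt (μ , []) v with largestRepeated μ ≟ 0
... | yes j≡0 = franklin-involutionAt v j≡0
... | no  j≢0 = merge-involutionAt v (n≢0⇒n>0 j≢0) just-nothing
involutionAt (μ , x ∷ ν) v with largestRepeated μ + largestRepeated μ ≤? x
... | yes 2j≤x = split-involutionAt v 2j≤x
... | no  2j≰x = merge-involutionAt v (n≢0⇒n>0 (λ j≡0 → 2j≰x (subst (λ j → j + j ≤ x) (sym j≡0) z≤n))) (just (≰⇒> 2j≰x))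

-- Signs and pentagonal numbers

sign : ℕ → ℤ
sign zero    = + 1
sign (suc k) = ℤ.- sign k

sign-parity : ∀ k → (k % 2 ≡ 0 × sign k ≡ + 1) ⊎ (k % 2 ≡ 1 × sign k ≡ -[1+ 0 ])
sign-parity zero          = inj₁ (refl , refl)
sign-parity (suc zero)    = inj₂ (refl , refl)
sign-parity (suc (suc k)) = Sum.map twice twice (sign-parity k)
  where
  twice : ∀ {r s} → k % 2 ≡ r × sign k ≡ s → suc (suc k) % 2 ≡ r × sign (suc (suc k)) ≡ s
  twice (k%2≡r , sign≡s) = k%2≡r , trans (ℤ.neg-involutive (sign k)) sign≡s

negOnePow≡sign : ∀ m → negOnePow m ≡ sign ∣ m ∣
negOnePow≡sign m with ∣ m ∣ % 2 | sign-parity ∣ m ∣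
... | _ | inj₁ (refl , sign≡1)  = sym sign≡1
... | _ | inj₂ (refl , sign≡-1) = sym sign≡-1

module _ {A : Set} (f : A → ℕ) where

  private
    even? : (x : A) → Dec (f x % 2 ≡ 0)
    even? x = f x % 2 ≟ 0

    odd? : (x : A) → Dec (f x % 2 ≡ 1)
    odd? x = f x % 2 ≟ 1

  evenCount-oddCount : ∀ xs → + length (filter even? xs) - + length (filter odd? xs) ≡ weightSum (sign ∘ f) xs
  evenCount-oddCount []       = refl
  evenCount-oddCount (x ∷ xs) = begin
    + length (filter even? (x ∷ xs)) - + length (filter odd? (x ∷ xs)) ≡⟨ step (sign-parity (f x)) ⟩
    sign (f x) ℤ.+ (E - O)                                            ≡⟨ cong (λ d → sign (f x) ℤ.+ d) (evenCount-oddCount xs) ⟩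
    sign (f x) ℤ.+ weightSum (sign ∘ f) xs                            ∎
    where
    open ≡-Reasoning
    E : ℤ
    E = + length (filter even? xs)
    O : ℤ
    O = + length (filter odd? xs)
    0≢1 : 0 ≢ 1
    0≢1 ()
    step : (f x % 2 ≡ 0 × sign (f x) ≡ + 1) ⊎ (f x % 2 ≡ 1 × sign (f x) ≡ -[1+ 0 ]) →
           + length (filter even? (x ∷ xs)) - + length (filter odd? (x ∷ xs)) ≡ sign (f x) ℤ.+ (E - O)
    step (inj₁ (even , sign≡1)) = begin
      + length (filter even? (x ∷ xs)) - + length (filter odd? (x ∷ xs))
        ≡⟨ cong₂ (λ as bs → + length as - + length bs) (List.filter-accept even? even) (List.filter-reject odd? (λ odd → 0≢1 (trans (sym even) odd))) ⟩
      + 1 ℤ.+ E - O       ≡⟨ ℤ.+-assoc (+ 1) E (ℤ.- O) ⟩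
      + 1 ℤ.+ (E - O)     ≡⟨ cong (ℤ._+ (E - O)) sign≡1 ⟨
      sign (f x) ℤ.+ (E - O) ∎
    step (inj₂ (odd , sign≡-1)) = begin
      + length (filter even? (x ∷ xs)) - + length (filter odd? (x ∷ xs))
        ≡⟨ cong₂ (λ as bs → + length as - + length bs) (List.filter-reject even? (λ even → 0≢1 (trans (sym even) odd))) (List.filter-accept odd? odd) ⟩
      E - (+ 1 ℤ.+ O)            ≡⟨ shift E O ⟩
      -[1+ 0 ] ℤ.+ (E - O)       ≡⟨ cong (ℤ._+ (E - O)) sign≡-1 ⟨
      sign (f x) ℤ.+ (E - O)     ∎
      where
      shift : ∀ a b → a - (+ 1 ℤ.+ b) ≡ ℤ.- + 1 ℤ.+ (a - b)
      shift = solve-∀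

pentagonalParts : ℤ → List ℕ
pentagonalParts (+ k)     = staircase k (suc k)
pentagonalParts -[1+ k ] = staircase (suc k) (suc k)

staircase-sum : ∀ k s → + 2 * + sum (staircase k s) ≡ + k * (+ 2 * + s ℤ.+ + k - + 1)
staircase-sum zero    s = refl
staircase-sum (suc k) s = begin
  + 2 * (+ k ℤ.+ + s ℤ.+ + S)                                ≡⟨ ℤ.*-distribˡ-+ (+ 2) (+ k ℤ.+ + s) (+ S) ⟩
  + 2 * (+ k ℤ.+ + s) ℤ.+ + 2 * + S                          ≡⟨ cong (λ t → + 2 * (+ k ℤ.+ + s) ℤ.+ t) (staircase-sum k s) ⟩
  + 2 * (+ k ℤ.+ + s) ℤ.+ + k * (+ 2 * + s ℤ.+ + k - + 1)    ≡⟨ grow (+ k) (+ s) ⟩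
  (+ 1 ℤ.+ + k) * (+ 2 * + s ℤ.+ (+ 1 ℤ.+ + k) - + 1)        ∎
  where
  open ≡-Reasoning
  S : ℕ
  S = sum (staircase k s)
  grow : ∀ k s → + 2 * (k ℤ.+ s) ℤ.+ k * (+ 2 * s ℤ.+ k - + 1) ≡ (+ 1 ℤ.+ k) * (+ 2 * s ℤ.+ (+ 1 ℤ.+ k) - + 1)
  grow = solve-∀

twoOmega≡twice-sum : ∀ m → twoOmega m ≡ + 2 * + sum (pentagonalParts m)
twoOmega≡twice-sum (+ k) = sym (trans (staircase-sum k (suc k)) (positive (+ k)))
  where
  positive : ∀ k → k * (+ 2 * (+ 1 ℤ.+ k) ℤ.+ k - + 1) ≡ k * (+ 3 * k ℤ.+ + 1)
  positive = solve-∀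
twoOmega≡twice-sum -[1+ k ] = sym (trans (staircase-sum (suc k) (suc k)) (negative (+ k)))
  where
  negative : ∀ k → (+ 1 ℤ.+ k) * (+ 2 * (+ 1 ℤ.+ k) ℤ.+ (+ 1 ℤ.+ k) - + 1) ≡ ℤ.- (+ 1 ℤ.+ k) * (+ 3 * ℤ.- (+ 1 ℤ.+ k) ℤ.+ + 1)
  negative = solve-∀

length-pentagonalParts : ∀ m → length (pentagonalParts m) ≡ ∣ m ∣
length-pentagonalParts (+ k)     = length-staircase k (suc k)
length-pentagonalParts -[1+ k ] = length-staircase (suc k) (suc k)

-- Otherwise 3 would divide 1.
3*i+1≢0 : ∀ i → + 3 * i ℤ.+ + 1 ≢ + 0
3*i+1≢0 i 3i+1≡0 = contradiction (∣1⇒≡1 (divides ∣ i ∣ 1≡∣i∣*3)) λ ()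
  where
  1≡-i*3 : + 1 ≡ ℤ.- i * + 3
  1≡-i*3 = sym (trans (rearrange i) (cong (+ 1 -_) 3i+1≡0))
    where
    rearrange : ∀ i → ℤ.- i * + 3 ≡ + 1 - (+ 3 * i ℤ.+ + 1)
    rearrange = solve-∀
  1≡∣i∣*3 : 1 ≡ ∣ i ∣ ℕ.* 3
  1≡∣i∣*3 = trans (cong ∣_∣ 1≡-i*3) (trans (ℤ.abs-* (ℤ.- i) (+ 3)) (cong (ℕ._* 3) (ℤ.∣-i∣≡∣i∣ i)))

twoOmega-difference : ∀ a b → twoOmega a - twoOmega b ≡ (a - b) * (+ 3 * (a ℤ.+ b) ℤ.+ + 1)
twoOmega-difference = factor
  where
  factor : ∀ a b → a * (+ 3 * a ℤ.+ + 1) - b * (+ 3 * b ℤ.+ + 1) ≡ (a - b) * (+ 3 * (a ℤ.+ b) ℤ.+ + 1)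
  factor = solve-∀

twoOmega-injective : ∀ a b → twoOmega a ≡ twoOmega b → a ≡ b
twoOmega-injective a b eq
  with ℤ.i*j≡0⇒i≡0∨j≡0 (a - b) (trans (sym (twoOmega-difference a b)) (trans (cong (_- twoOmega b) eq) (ℤ.+-inverseʳ (twoOmega b))))
... | inj₁ a-b≡0      = ℤ.i-j≡0⇒i≡j a b a-b≡0
... | inj₂ 3[a+b]+1≡0 = ⊥-elim (3*i+1≢0 (a ℤ.+ b) 3[a+b]+1≡0)

pentagonalParts-decreasing : ∀ m → Decreasing (pentagonalParts m)
pentagonalParts-decreasing (+ k)     = staircase-decreasing k (suc k)
pentagonalParts-decreasing -[1+ k ] = staircase-decreasing (suc k) (suc k)

pentagonalParts-positive : ∀ m → Positive (pentagonalParts m)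
pentagonalParts-positive (+ k)     = staircase-positive k (suc k) (s≤s z≤n)
pentagonalParts-positive -[1+ k ] = staircase-positive (suc k) (suc k) (s≤s z≤n)

pentagonalParts-exceptional : ∀ m → Exceptional (pentagonalParts m)
pentagonalParts-exceptional (+ k)     = staircase-exceptional k (inj₂ refl)
pentagonalParts-exceptional -[1+ k ] = staircase-exceptional (suc k) (inj₁ refl)

pentagonalStaircase⇒pentagonalParts : ∀ {μ} → PentagonalStaircase μ → ∃ λ m → μ ≡ pentagonalParts m
pentagonalStaircase⇒pentagonalParts (k     , inj₂ μ≡) = + k , μ≡
pentagonalStaircase⇒pentagonalParts (zero  , inj₁ μ≡) = + 0 , μ≡
pentagonalStaircase⇒pentagonalParts (suc k , inj₁ μ≡) = -[1+ k ] , μ≡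

pentagonal-fixed : ∀ m → involution (pentagonalParts m , []) ≡ (pentagonalParts m , [])
pentagonal-fixed m = trans (involution-franklin _ (decreasing⇒largestRepeated≡0 (pentagonalParts-decreasing m)))
                           (cong (_, []) (franklin-exceptional _ (pentagonalParts-exceptional m)))

pentagonal-valid : ∀ {n} m → + 2 * + n ≡ twoOmega m → IsEvenOverpartitionOf n (pentagonalParts m , [])
pentagonal-valid {n} m 2n≡ω =
  ( trans (+-identityʳ _) (sym (ℤ.+-injective (ℤ.*-cancelˡ-≡ (+ 2) (+ n) _ (trans 2n≡ω (twoOmega≡twice-sum m)))))
  , (pentagonalParts-positive m , Linked.map <⇒≤ (pentagonalParts-decreasing m))
  , ([] , [] , []) )

fixedPoint⇒pentagonal : ∀ {n p} → IsEvenOverpartitionOf n p → involution p ≡ p →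
                        ∃ λ m → p ≡ (pentagonalParts m , []) × + 2 * + n ≡ twoOmega m
fixedPoint⇒pentagonal {n} {μ , ν} v@(sum≡n , _) fixed with InvolutionAt.fixed-or-moves (involutionAt (μ , ν) v)
... | inj₂ (inj₁ more)  = ⊥-elim (1+n≢n (trans (sym more) (cong numParts fixed)))
... | inj₂ (inj₂ fewer) = ⊥-elim (1+n≢n (sym (trans fewer (cong (suc ∘ numParts) fixed))))
... | inj₁ (_ , refl , staircase) with pentagonalStaircase⇒pentagonalParts staircase
...   | m , refl = m , refl , (begin
  + 2 * + n                                 ≡⟨ cong (λ k → + 2 * + k) (trans (sym sum≡n) (+-identityʳ _)) ⟩
  + 2 * + sum (pentagonalParts m)           ≡⟨ twoOmega≡twice-sum m ⟨
  twoOmega m                                ∎)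
  where open ≡-Reasoning

_≟ₒ_ : DecidableEquality OverPair
_≟ₒ_ = Product.≡-dec (List.≡-dec _≟_) (List.≡-dec _≟_)

fixedPoints : ℕ → List OverPair
fixedPoints n = filter (IsFixed? _≟ₒ_ involution) (evenOverpartitions n)

signedCount≡fixedPoints : ∀ n → + d2e n - + d2o n ≡ weightSum (sign ∘ numParts) (fixedPoints n)
signedCount≡fixedPoints n = trans (evenCount-oddCount numParts (evenOverpartitions n))
  (weightSum-fixedPoints _≟ₒ_ involution (sign ∘ numParts) record
    { unique         = evenOverpartitions-unique n
    ; closed         = ∈-evenOverpartitions ∘ InvolutionAt.valid ∘ at
    ; involutive     = InvolutionAt.involutive ∘ at
    ; sign-reversing = sign-reversing
    })
  where
  at : ∀ {p} → p ∈ evenOverpartitions n → InvolutionAt n p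
  at p∈ = involutionAt _ (evenOverpartitions-sound p∈)
  sign-reversing : ∀ {p} → p ∈ evenOverpartitions n → involution p ≢ p →
                   sign (numParts (involution p)) ≡ ℤ.- sign (numParts p)
  sign-reversing {p} p∈ moved with InvolutionAt.fixed-or-moves (at p∈)
  ... | inj₁ (fixed , _)  = ⊥-elim (moved fixed)
  ... | inj₂ (inj₁ more)  = cong sign more
  ... | inj₂ (inj₂ fewer) = trans (sym (ℤ.neg-involutive _)) (cong (ℤ.-_ ∘ sign) (sym fewer))

∈-fixedPoints⇒pentagonal : ∀ n {p} → p ∈ fixedPoints n → ∃ λ m → p ≡ (pentagonalParts m , []) × + 2 * + n ≡ twoOmega m
∈-fixedPoints⇒pentagonal n p∈ with ∈-filter⁻ (IsFixed? _≟ₒ_ involution) {xs = evenOverpartitions n} p∈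
... | p∈ops , fixed = fixedPoint⇒pentagonal (evenOverpartitions-sound {n} p∈ops) fixed

fixedPoints-pentagonal : ∀ n m → + 2 * + n ≡ twoOmega m → fixedPoints n ≡ (pentagonalParts m , []) ∷ []
fixedPoints-pentagonal n m 2n≡ω = unique-singleton (Unique.filter⁺ (IsFixed? _≟ₒ_ involution) (evenOverpartitions-unique n))
  (∈-filter⁺ (IsFixed? _≟ₒ_ involution) (∈-evenOverpartitions (pentagonal-valid {n} m 2n≡ω)) (pentagonal-fixed m))
  λ p∈ → let (m′ , p≡ , 2n≡ω′) = ∈-fixedPoints⇒pentagonal n p∈
         in trans p≡ (cong (λ m → pentagonalParts m , []) (twoOmega-injective m′ m (trans (sym 2n≡ω′) 2n≡ω)))

fixedPoints-nonPentagonal : ∀ n → (∀ m → + 2 * + n ≢ twoOmega m) → fixedPoints n ≡ []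
fixedPoints-nonPentagonal n ¬pentagonal = no-members λ p∈ →
  let (m , _ , 2n≡ω) = ∈-fixedPoints⇒pentagonal n p∈ in ¬pentagonal m 2n≡ω

theorem5 : (n : ℕ) →
    ((m : ℤ) → + 2 * + n ≡ twoOmega m → + d2e n - + d2o n ≡ negOnePow m)
    × (((m : ℤ) → + 2 * + n ≢ twoOmega m) → + d2e n - + d2o n ≡ + 0)
theorem5 n = pentagonal , nonPentagonal
  where
  open ≡-Reasoning
  pentagonal : (m : ℤ) → + 2 * + n ≡ twoOmega m → + d2e n - + d2o n ≡ negOnePow m
  pentagonal m 2n≡ω = begin
    + d2e n - + d2o n                               ≡⟨ signedCount≡fixedPoints n ⟩
    weightSum (sign ∘ numParts) (fixedPoints n)     ≡⟨ cong (weightSum (sign ∘ numParts)) (fixedPoints-pentagonal n m 2n≡ω) ⟩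
    sign (length (pentagonalParts m) + 0) ℤ.+ + 0   ≡⟨ ℤ.+-identityʳ _ ⟩
    sign (length (pentagonalParts m) + 0)           ≡⟨ cong sign (trans (+-identityʳ _) (length-pentagonalParts m)) ⟩
    sign ∣ m ∣                                      ≡⟨ negOnePow≡sign m ⟨
    negOnePow m                                     ∎
  nonPentagonal : ((m : ℤ) → + 2 * + n ≢ twoOmega m) → + d2e n - + d2o n ≡ + 0
  nonPentagonal ¬pentagonal = begin
    + d2e n - + d2o n                               ≡⟨ signedCount≡fixedPoints n ⟩
    weightSum (sign ∘ numParts) (fixedPoints n)     ≡⟨ cong (weightSum (sign ∘ numParts)) (fixedPoints-nonPentagonal n ¬pentagonal) ⟩
    + 0                                             ∎
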